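{- Let $b \ge 1$ be an integer and let $d_1, \dots, d_b$ be odd integers with $d_j \ge 3$. For each integer $m$ with $b \mid m$ and $d_j \le 2m-3$ for all $j$, let $G_{2m}$ be the graph on vertex set $\{1, \dots, 2m\}$ whose edges are the Hamiltonian cycle edges $\{x, x+1\}$ for $1 \le x \le 2m-1$ together with $\{2m,1\}$, and, for each odd vertex $x = 2i-1$ ($1 \le i \le m$), the chord joining $x$ to the vertex $y \in \{1,\dots,2m\}$ with $y \equiv x + d_j \pmod{2m}$, where $j \in \{1,\dots,b\}$ satisfies $j \equiv i \pmod b$. Then there exists a positive integer $k$ such that all Hamiltonian trivalent bipartite graphs $G_{2b(k+i)}$, $i = 0, 1, 2, \dots$ (i.e., those $G_{2b(k+i)}$ that are simple $3$-regular graphs), have the same girth.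
   Context: The girth of a graph is the length of its shortest cycle. In the paper, a Hamiltonian trivalent bipartite graph (HBG) of order $2m$ with symmetry factor $b$ ($b \mid m$) and "D3 chord indices" $d_1,\dots,d_b$ is exactly the graph $G_{2m}$ constructed in the claim, when that construction yields a simple $3$-regular graph. -}

module Defs where

open import Data.Nat using (ℕ; zero; suc; _+_; _*_; _∸_; _≤_; _<_; NonZero)
open import Data.Nat.DivMod using (_mod_)
open import Data.Nat.Divisibility using (_∣_)
open import Data.Fin using (Fin)
open import Data.List using (List; length)
open import Data.List.Membership.Propositional using (_∈_)
open import Data.List.Relation.Unary.Unique.Propositional using (Unique)
open import Data.Product using (Σ; _×_; ∃-syntax)
open import Data.Sum using (_⊎_)
open import Relation.Binary.PropositionalEquality using (_≡_)

-- Convention: vertices 1..n of the paper are represented by 0..n-1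
-- (paper vertex x  <->  our vertex x - 1).

ModEq : ℕ → ℕ → ℕ → Set
ModEq n a c = ∃[ p ] ∃[ q ] (a + p * n ≡ c + q * n)

-- Chord of G_{2m}: the paper's odd vertex x = 2i-1 (ours: u = 2t, t = i-1)
-- is joined to y ≡ x + d_j (mod 2m) where j ≡ i (mod b), i.e. (0-based)
-- j-1 = t mod b.
Chord : (b : ℕ) .{{_ : NonZero b}} → (Fin b → ℕ) → ℕ → ℕ → ℕ → Set
Chord b d m u v = ∃[ t ] (u ≡ 2 * t × ModEq (2 * m) v (u + d (t mod b)))

-- Adjacency of G_{2m} (a relation, so the graph is simple; symmetric by construction).
Adj : (b : ℕ) .{{_ : NonZero b}} → (Fin b → ℕ) → ℕ → ℕ → ℕ → Set
Adj b d m u v =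
  u < 2 * m × v < 2 * m ×
  (ModEq (2 * m) v (suc u) ⊎ ModEq (2 * m) u (suc v) ⊎
   Chord b d m u v ⊎ Chord b d m v u)

Regular3 : ℕ → (ℕ → ℕ → Set) → Set
Regular3 n A = ∀ v → v < n →
  Σ (List ℕ) λ l → length l ≡ 3 × Unique l ×
    (∀ w → (A v w → w ∈ l) × (w ∈ l → A v w))

IsCycle : ℕ → (ℕ → ℕ → Set) → ℕ → (ℕ → ℕ) → Set
IsCycle n A ℓ c =
  3 ≤ ℓ ×
  (∀ i → i < ℓ → c i < n) ×
  (∀ i j → i < ℓ → j < ℓ → c i ≡ c j → i ≡ j) ×
  (∀ i → suc i < ℓ → A (c i) (c (suc i))) ×
  A (c (ℓ ∸ 1)) (c 0)

HasCycle : ℕ → (ℕ → ℕ → Set) → ℕ → Set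
HasCycle n A ℓ = Σ (ℕ → ℕ) (IsCycle n A ℓ)

IsGirth : ℕ → (ℕ → ℕ → Set) → ℕ → Set
IsGirth n A g = HasCycle n A g × (∀ ℓ → HasCycle n A ℓ → g ≤ ℓ)

-- Every G_{2m} with b ∣ m is the quotient, modulo 2m, of one infinite graph on ℕ with
-- edges x – x+1 and 2t – 2t + d(t mod b); that graph is invariant under translation
-- by 2b.  If S bounds the chord lengths, a cycle of G_{2m} of length ℓ with ℓS < 2m
-- lifts to a cycle of the infinite graph, which a translation by a multiple of 2b
-- moves into [0, 2b + 2ℓS); conversely every cycle inside [0, W) with W ≤ 2m is a
-- cycle of G_{2m}.  Since 0, 1, …, d(0 mod b) is a cycle of length L, for
-- W = 2b + 2LS and all 2m ≥ W the girth of G_{2m} is the length of a shortest cycle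
-- of the infinite graph inside [0, W), which does not depend on m.
module Submission where

open import Defs
open import Data.Nat using (ℕ; zero; suc; _+_; _*_; _∸_; _≤_; _<_; NonZero; z≤n; s≤s; z<s; _≟_; _<?_; _≤?_; ∣_-_∣)
open import Data.Nat.Properties
open import Data.Nat.DivMod using (_%_; _/_; _mod_; [m+kn]%n≡m%n; m%n<n; m/n*n≤m; m%n≡m∸m/n*n)
open import Data.Nat.Divisibility using (_∣_)
open import Data.Nat.Induction using (<-rec)
open import Data.Nat.Tactic.RingSolver using (solve)
open import Data.Fin using (Fin)
open import Data.Fin.Properties using (fromℕ<-cong)
open import Data.List using ([]; _∷_; tabulate)
open import Data.List.Extrema.Nat using (max; v≤max⁺; ⊥≤max)
open import Data.List.Membership.Propositional.Properties using (∈-tabulate⁺)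
import Data.List.Relation.Unary.Any as Any
open import Data.Product using (Σ; _×_; _,_; proj₁; proj₂; ∃; ∃-syntax)
open import Data.Sum using (_⊎_; inj₁; inj₂)
open import Data.Empty using (⊥-elim)
open import Function using (_∘_)
open import Relation.Nullary using (¬_; Dec; yes; no)
open import Relation.Nullary.Decidable using (map′; _×-dec_; _⊎-dec_; _→-dec_)
open import Relation.Binary.PropositionalEquality

ModEq-sym : ∀ {n a c} → ModEq n a c → ModEq n c a
ModEq-sym (p , q , e) = q , p , sym e

ModEq-trans : ∀ {n a b c} → ModEq n a b → ModEq n b c → ModEq n a c
ModEq-trans {n} {a} {b} {c} (p , q , a≡b) (r , s , b≡c) = p + r , q + s , (begin
  a + (p + r) * n    ≡⟨ solve (a ∷ p ∷ r ∷ n ∷ []) ⟩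
  a + p * n + r * n  ≡⟨ cong (_+ r * n) a≡b ⟩
  b + q * n + r * n  ≡⟨ solve (b ∷ q ∷ r ∷ n ∷ []) ⟩
  b + r * n + q * n  ≡⟨ cong (_+ q * n) b≡c ⟩
  c + s * n + q * n  ≡⟨ solve (c ∷ s ∷ q ∷ n ∷ []) ⟩
  c + (q + s) * n    ∎)
  where open ≡-Reasoning

ModEq-+n : ∀ n a → ModEq n (a + n) a
ModEq-+n n a = 0 , 1 , +-assoc a n 0

ModEq-suc : ∀ {n a c} → ModEq n a c → ModEq n (suc a) (suc c)
ModEq-suc (p , q , e) = p , q , cong suc e

ModEq-suc⁻¹ : ∀ {n a c} → ModEq n (suc a) (suc c) → ModEq n a c
ModEq-suc⁻¹ (p , q , e) = p , q , suc-injective e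

ModEq-+ʳ : ∀ {n a c} x → ModEq n a c → ModEq n (a + x) (c + x)
ModEq-+ʳ {n} {a} {c} x (p , q , e) = p , q , (begin
  a + x + p * n  ≡⟨ solve (a ∷ x ∷ p ∷ n ∷ []) ⟩
  a + p * n + x  ≡⟨ cong (_+ x) e ⟩
  c + q * n + x  ≡⟨ solve (c ∷ q ∷ n ∷ x ∷ []) ⟩
  c + x + q * n  ∎)
  where open ≡-Reasoning

ModEq-+ʳ⁻¹ : ∀ {n a c} x → ModEq n (a + x) (c + x) → ModEq n a c
ModEq-+ʳ⁻¹ {n} {a} {c} x (p , q , e) = p , q , +-cancelʳ-≡ x _ _ (begin
  a + p * n + x  ≡⟨ solve (a ∷ p ∷ n ∷ x ∷ []) ⟩
  a + x + p * n  ≡⟨ e ⟩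
  c + x + q * n  ≡⟨ solve (c ∷ x ∷ q ∷ n ∷ []) ⟩
  c + q * n + x  ∎)
  where open ≡-Reasoning

ModEq-divisor : ∀ {k r a c} → ModEq (k * r) a c → ModEq k a c
ModEq-divisor {k} {r} {a} {c} (p , q , e) = p * r , q * r , (begin
  a + p * r * k    ≡⟨ cong (a +_) (solve (p ∷ r ∷ k ∷ [])) ⟩
  a + p * (k * r)  ≡⟨ e ⟩
  c + q * (k * r)  ≡⟨ cong (c +_) (solve (q ∷ k ∷ r ∷ [])) ⟩
  c + q * r * k    ∎)
  where open ≡-Reasoning

ModEq⇒mod≡ : ∀ {n a c} .{{_ : NonZero n}} → ModEq n a c → a mod n ≡ c mod n
ModEq⇒mod≡ {n} {a} {c} (p , q , e) = fromℕ<-cong _ _ a%n≡c%n (m%n<n a n) (m%n<n c n)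
  where
  a%n≡c%n : a % n ≡ c % n
  a%n≡c%n = trans (sym ([m+kn]%n≡m%n a p n)) (trans (cong (_% n) e) ([m+kn]%n≡m%n c q n))

ModEq-close⇒≡ : ∀ {n a c} → ModEq n a c → ∣ a - c ∣ < n → a ≡ c
ModEq-close⇒≡ (p , q , e) = go p q e
  where
  far : ∀ {n a c} q → a ≡ c + (n + q * n) → ¬ ∣ a - c ∣ < n
  far {n} {a} {c} q a≡ lt = <⇒≱ lt (+-cancelˡ-≤ c n _ (begin
    c + n              ≤⟨ m≤m+n (c + n) (q * n) ⟩
    c + n + q * n      ≡⟨ trans (+-assoc c n (q * n)) (sym a≡) ⟩
    a                  ≤⟨ m≤n+∣m-n∣ a c ⟩
    c + ∣ a - c ∣      ∎))
    where open ≤-Reasoning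
  go : ∀ {n a c} p q → a + p * n ≡ c + q * n → ∣ a - c ∣ < n → a ≡ c
  go {n} {a} {c} zero zero e _ = trans (sym (+-identityʳ a)) (trans e (+-identityʳ c))
  go {n} {a} {c} zero (suc q) e lt = ⊥-elim (far q (trans (sym (+-identityʳ a)) e) lt)
  go {n} {a} {c} (suc p) zero e lt =
    ⊥-elim (far p (trans (sym (+-identityʳ c)) (sym e)) (subst (_< n) (∣-∣-comm a c) lt))
  go {n} {a} {c} (suc p) (suc q) e lt = go p q (+-cancelʳ-≡ n _ _ (begin
    a + p * n + n      ≡⟨ solve (a ∷ p ∷ n ∷ []) ⟩
    a + (n + p * n)    ≡⟨ e ⟩
    c + (n + q * n)    ≡⟨ solve (c ∷ n ∷ q ∷ []) ⟩
    c + q * n + n      ∎)) lt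
    where open ≡-Reasoning

ModEq-double⇒even : ∀ {b p t} → ModEq (2 * b) p (2 * t) → ∃[ s ] (p ≡ 2 * s × ModEq b s t)
ModEq-double⇒even {b} {p} {t} (P , Q , e) = s , p≡2s , P , Q , m∸n+n≡m Pb≤
  where
  s = t + Q * b ∸ P * b
  2[t+Qb]≡p+2Pb : 2 * (t + Q * b) ≡ p + 2 * (P * b)
  2[t+Qb]≡p+2Pb = begin
    2 * (t + Q * b)      ≡⟨ solve (t ∷ Q ∷ b ∷ []) ⟩
    2 * t + Q * (2 * b)  ≡⟨ sym e ⟩
    p + P * (2 * b)      ≡⟨ cong (p +_) (solve (P ∷ b ∷ [])) ⟩
    p + 2 * (P * b)      ∎
    where open ≡-Reasoning
  Pb≤ : P * b ≤ t + Q * b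
  Pb≤ = *-cancelˡ-≤ 2 (subst (2 * (P * b) ≤_) (sym 2[t+Qb]≡p+2Pb) (m≤n+m _ p))
  p≡2s : p ≡ 2 * s
  p≡2s = sym (begin
    2 * (t + Q * b ∸ P * b)          ≡⟨ *-distribˡ-∸ 2 (t + Q * b) (P * b) ⟩
    2 * (t + Q * b) ∸ 2 * (P * b)    ≡⟨ cong (_∸ 2 * (P * b)) 2[t+Qb]≡p+2Pb ⟩
    p + 2 * (P * b) ∸ 2 * (P * b)    ≡⟨ m+n∸n≡m p (2 * (P * b)) ⟩
    p                                ∎)
    where open ≡-Reasoning

Least : (ℕ → Set) → ℕ → Set
Least P g = P g × (∀ ℓ → P ℓ → g ≤ ℓ)

least-witness : {P : ℕ → Set} → (∀ n → Dec (P n)) → ∀ n → P n → ∃ (Least P)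
least-witness {P} P? = <-rec _ search
  where
  search : ∀ n → (∀ {m} → m < n → P m → ∃ (Least P)) → P n → ∃ (Least P)
  search n smaller pn with anyUpTo? P? n
  ... | yes (m , m<n , pm) = smaller m<n pm
  ... | no none = n , pn , λ ℓ pℓ → ≮⇒≥ λ ℓ<n → none (ℓ , ℓ<n , pℓ)

_◂_ : ℕ → (ℕ → ℕ) → ℕ → ℕ
(a ◂ f) zero = a
(a ◂ f) (suc i) = f i

◂-cong : ∀ a {ℓ f g} → (∀ i → i < ℓ → f i ≡ g i) → ∀ i → i < suc ℓ → (a ◂ f) i ≡ (a ◂ g) i
◂-cong a f≗g zero _ = refl
◂-cong a f≗g (suc i) (s≤s i<ℓ) = f≗g i i<ℓ

◂-η : ∀ f i → f i ≡ (f 0 ◂ (f ∘ suc)) i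
◂-η f zero = refl
◂-η f (suc i) = refl

any-bounded-function? : ∀ n ℓ {P : (ℕ → ℕ) → Set} →
  (∀ {f g} → (∀ i → i < ℓ → f i ≡ g i) → P f → P g) → (∀ f → Dec (P f)) →
  Dec (∃[ f ] ((∀ i → i < ℓ → f i < n) × P f))
any-bounded-function? n zero {P} P-local P? with P? (λ _ → 0)
... | yes p = yes (_ , (λ _ ()) , p)
... | no ¬p = no λ (f , _ , pf) → ¬p (P-local (λ _ ()) pf)
any-bounded-function? n (suc ℓ) {P} P-local P?
  with anyUpTo? (λ a → any-bounded-function? n ℓ (P-local ∘ ◂-cong a) (P? ∘ (a ◂_))) n
... | yes (a , a<n , f , f<n , pf) = yes (a ◂ f , bound , pf)
  where
  bound : ∀ i → i < suc ℓ → (a ◂ f) i < n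
  bound zero _ = a<n
  bound (suc i) (s≤s i<ℓ) = f<n i i<ℓ
... | no none = no λ (f , f<n , pf) →
  none (f 0 , f<n 0 z<s , f ∘ suc , (λ i i<ℓ → f<n (suc i) (s≤s i<ℓ)) , P-local (λ i _ → ◂-η f i) pf)

module _ {n : ℕ} {A : ℕ → ℕ → Set} where

  IsCycle-local : ∀ {ℓ c c′} → (∀ i → i < ℓ → c i ≡ c′ i) → IsCycle n A ℓ c → IsCycle n A ℓ c′
  IsCycle-local {suc ℓ} c≗c′ (3≤ℓ , c<n , c-inj , c-adj , c-close) =
    3≤ℓ ,
    (λ i i<ℓ → subst (_< n) (c≗c′ i i<ℓ) (c<n i i<ℓ)) ,
    (λ i j i<ℓ j<ℓ e → c-inj i j i<ℓ j<ℓ (trans (c≗c′ i i<ℓ) (trans e (sym (c≗c′ j j<ℓ))))) ,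
    (λ i i+1<ℓ → subst₂ A (c≗c′ i (<-trans (n<1+n i) i+1<ℓ)) (c≗c′ (suc i) i+1<ℓ) (c-adj i i+1<ℓ)) ,
    subst₂ A (c≗c′ ℓ ≤-refl) (c≗c′ 0 z<s) c-close

  isCycle? : (∀ x y → Dec (A x y)) → ∀ ℓ c → Dec (IsCycle n A ℓ c)
  isCycle? A? ℓ c =
    3 ≤? ℓ ×-dec
    map′ (λ h i → h {i}) (λ h {i} → h i) (allUpTo? (λ i → c i <? n) ℓ) ×-dec
    map′ (λ h i j i<ℓ j<ℓ → h i<ℓ j<ℓ) (λ h {i} i<ℓ {j} j<ℓ → h i j i<ℓ j<ℓ)
      (allUpTo? (λ i → allUpTo? (λ j → c i ≟ c j →-dec i ≟ j) ℓ) ℓ) ×-dec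
    map′ (λ h i i+1<ℓ → h (<-trans (n<1+n i) i+1<ℓ) i+1<ℓ) (λ h {i} _ → h i)
      (allUpTo? (λ i → suc i <? ℓ →-dec A? (c i) (c (suc i))) ℓ) ×-dec
    A? (c (ℓ ∸ 1)) (c 0)

  hasCycle? : (∀ x y → Dec (A x y)) → ∀ ℓ → Dec (HasCycle n A ℓ)
  hasCycle? A? ℓ = map′ (λ (c , _ , cyc) → c , cyc) (λ (c , cyc) → c , proj₁ (proj₂ cyc) , cyc)
    (any-bounded-function? n ℓ IsCycle-local (isCycle? A? ℓ))

IsCycle-map : ∀ {n n′ A B ℓ c} (Q : ℕ → Set) (f : ℕ → ℕ) →
  (∀ {x} → Q x → f x < n′) →
  (∀ {x y} → Q x → Q y → f x ≡ f y → x ≡ y) →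
  (∀ {x y} → Q x → Q y → A x y → B (f x) (f y)) →
  (∀ i → i < ℓ → Q (c i)) →
  IsCycle n A ℓ c → IsCycle n′ B ℓ (f ∘ c)
IsCycle-map {ℓ = suc ℓ} Q f f< f-inj f-hom Qc (3≤ℓ , _ , c-inj , c-adj , c-close) =
  3≤ℓ ,
  (λ i i<ℓ → f< (Qc i i<ℓ)) ,
  (λ i j i<ℓ j<ℓ e → c-inj i j i<ℓ j<ℓ (f-inj (Qc i i<ℓ) (Qc j j<ℓ) e)) ,
  (λ i i+1<ℓ → f-hom (Qc i (<-trans (n<1+n i) i+1<ℓ)) (Qc (suc i) i+1<ℓ) (c-adj i i+1<ℓ)) ,
  f-hom (Qc ℓ ≤-refl) (Qc 0 z<s) c-close

IsCycle-≤ : ∀ {n n′ A ℓ c} → n ≤ n′ → IsCycle n A ℓ c → IsCycle n′ A ℓ c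
IsCycle-≤ n≤n′ (3≤ℓ , c<n , rest) = 3≤ℓ , (λ i i<ℓ → <-≤-trans (c<n i i<ℓ) n≤n′) , rest

∣n-1+n∣≡1 : ∀ n → ∣ n - suc n ∣ ≡ 1
∣n-1+n∣≡1 zero = refl
∣n-1+n∣≡1 (suc n) = ∣n-1+n∣≡1 n

∣m-n∣≤o⇒m≤n+o : ∀ {m n o} → ∣ m - n ∣ ≤ o → m ≤ n + o
∣m-n∣≤o⇒m≤n+o {m} {n} le = ≤-trans (m≤n+∣m-n∣ m n) (+-monoʳ-≤ n le)

∣m-n∣≤o⇒n≤m+o : ∀ {m n o} → ∣ m - n ∣ ≤ o → n ≤ m + o
∣m-n∣≤o⇒n≤m+o {m} {n} le = ∣m-n∣≤o⇒m≤n+o (subst (_≤ _) (∣-∣-comm m n) le)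

∣m-n∣≤o⇒m∸o≤n : ∀ {m n o} → ∣ m - n ∣ ≤ o → m ∸ o ≤ n
∣m-n∣≤o⇒m∸o≤n {m} {n} {o} le = m≤n+o⇒m∸n≤o m o (subst (m ≤_) (+-comm n o) (∣m-n∣≤o⇒m≤n+o le))

∣m-n∣≤o∧o+k≤m⇒k≤n : ∀ {m n o k} → o + k ≤ m → ∣ m - n ∣ ≤ o → k ≤ n
∣m-n∣≤o∧o+k≤m⇒k≤n {m} {o = o} {k} o+k≤m le =
  ≤-trans (m+n≤o⇒m≤o∸n k (subst (_≤ m) (+-comm o k) o+k≤m)) (∣m-n∣≤o⇒m∸o≤n {m} le)

module Cover (b : ℕ) .{{_ : NonZero b}} (d : Fin b → ℕ) where

  Chord∞ : ℕ → ℕ → Set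
  Chord∞ x y = ∃[ t ] (x ≡ 2 * t × y ≡ x + d (t mod b))

  Adj∞ : ℕ → ℕ → Set
  Adj∞ x y = y ≡ suc x ⊎ x ≡ suc y ⊎ Chord∞ x y ⊎ Chord∞ y x

  chord∞? : ∀ x y → Dec (Chord∞ x y)
  chord∞? x y = map′ (λ (t , _ , e) → t , e) (λ (t , x≡2t , e) → t , t<1+x x≡2t , x≡2t , e)
    (anyUpTo? (λ t → x ≟ 2 * t ×-dec y ≟ x + d (t mod b)) (suc x))
    where
    t<1+x : ∀ {t} → x ≡ 2 * t → t < suc x
    t<1+x {t} refl = s≤s (m≤m+n t (t + 0))

  adj∞? : ∀ x y → Dec (Adj∞ x y)
  adj∞? x y = y ≟ suc x ⊎-dec x ≟ suc y ⊎-dec chord∞? x y ⊎-dec chord∞? y x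

  Adj∞⇒Adj : ∀ {m x y} → x < 2 * m → y < 2 * m → Adj∞ x y → Adj b d m x y
  Adj∞⇒Adj x< y< (inj₁ e) = x< , y< , inj₁ (0 , 0 , cong (_+ 0) e)
  Adj∞⇒Adj x< y< (inj₂ (inj₁ e)) = x< , y< , inj₂ (inj₁ (0 , 0 , cong (_+ 0) e))
  Adj∞⇒Adj x< y< (inj₂ (inj₂ (inj₁ (t , x≡2t , e)))) =
    x< , y< , inj₂ (inj₂ (inj₁ (t , x≡2t , 0 , 0 , cong (_+ 0) e)))
  Adj∞⇒Adj x< y< (inj₂ (inj₂ (inj₂ (t , y≡2t , e)))) =
    x< , y< , inj₂ (inj₂ (inj₂ (t , y≡2t , 0 , 0 , cong (_+ 0) e)))

  Chord∞-∸ : ∀ q {x y} → q * (2 * b) ≤ x → Chord∞ x y → Chord∞ (x ∸ q * (2 * b)) (y ∸ q * (2 * b))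
  Chord∞-∸ q {x} {y} T≤x (t , x≡2t , y≡) = t ∸ q * b , x∸T≡ , y∸T≡
    where
    T = q * (2 * b)
    T≡ : q * (2 * b) ≡ 2 * (q * b)
    T≡ = solve (q ∷ b ∷ [])
    qb≤t : q * b ≤ t
    qb≤t = *-cancelˡ-≤ 2 (subst₂ _≤_ T≡ x≡2t T≤x)
    x∸T≡ : x ∸ T ≡ 2 * (t ∸ q * b)
    x∸T≡ = trans (cong₂ _∸_ x≡2t T≡) (sym (*-distribˡ-∸ 2 t (q * b)))
    same-index : (t ∸ q * b) mod b ≡ t mod b
    same-index = ModEq⇒mod≡ (q , 0 , trans (m∸n+n≡m qb≤t) (sym (+-identityʳ t)))
    y∸T≡ : y ∸ T ≡ x ∸ T + d ((t ∸ q * b) mod b)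
    y∸T≡ = begin
      y ∸ T                      ≡⟨ cong (_∸ T) y≡ ⟩
      x + d (t mod b) ∸ T        ≡⟨ +-∸-comm (d (t mod b)) T≤x ⟩
      x ∸ T + d (t mod b)        ≡⟨ cong (λ j → x ∸ T + d j) (sym same-index) ⟩
      x ∸ T + d ((t ∸ q * b) mod b) ∎
      where open ≡-Reasoning

  Adj∞-∸ : ∀ q {x y} → q * (2 * b) ≤ x → q * (2 * b) ≤ y → Adj∞ x y →
           Adj∞ (x ∸ q * (2 * b)) (y ∸ q * (2 * b))
  Adj∞-∸ q T≤x T≤y (inj₁ refl) = inj₁ (+-∸-assoc 1 T≤x)
  Adj∞-∸ q T≤x T≤y (inj₂ (inj₁ refl)) = inj₂ (inj₁ (+-∸-assoc 1 T≤y))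
  Adj∞-∸ q T≤x T≤y (inj₂ (inj₂ (inj₁ ch))) = inj₂ (inj₂ (inj₁ (Chord∞-∸ q T≤x ch)))
  Adj∞-∸ q T≤x T≤y (inj₂ (inj₂ (inj₂ ch))) = inj₂ (inj₂ (inj₂ (Chord∞-∸ q T≤y ch)))

  -- Translating by the largest multiple of 2b below x₀ ∸ h preserves Adj∞ and puts the
  -- cycle into [0, 2b + 2h).
  cycle-window : ∀ {N ℓ c} x₀ h → h ≤ x₀ → (∀ i → i < ℓ → ∣ x₀ - c i ∣ ≤ h) →
                 IsCycle N Adj∞ ℓ c → HasCycle (2 * b + 2 * h) Adj∞ ℓ
  cycle-window {c = c} x₀ h h≤x₀ near cyc =
    _ , IsCycle-map {B = Adj∞} Q (_∸ T) shifted< shifted-inj shifted-adj Qc cyc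
    where
    instance _ = m*n≢0 2 b
    lo = x₀ ∸ h
    q = lo / (2 * b)
    T = q * (2 * b)
    Q : ℕ → Set
    Q x = lo ≤ x × x ≤ x₀ + h
    Qc : ∀ i → i < _ → Q (c i)
    Qc i i<ℓ = ∣m-n∣≤o⇒m∸o≤n (near i i<ℓ) , ∣m-n∣≤o⇒n≤m+o (near i i<ℓ)
    T≤ : ∀ {x} → Q x → T ≤ x
    T≤ (lo≤x , _) = ≤-trans (m/n*n≤m lo (2 * b)) lo≤x
    shifted< : ∀ {x} → Q x → x ∸ T < 2 * b + 2 * h
    shifted< {x} (_ , x≤) = begin-strict
      x ∸ T               ≤⟨ ∸-monoˡ-≤ T x≤ ⟩
      x₀ + h ∸ T          ≡⟨ cong (_∸ T) (begin-equality
                               x₀ + h          ≡⟨ cong (_+ h) (sym (m∸n+n≡m h≤x₀)) ⟩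
                               lo + h + h      ≡⟨ +-assoc lo h h ⟩
                               lo + (h + h)    ≡⟨ cong (λ k → lo + (h + k)) (sym (+-identityʳ h)) ⟩
                               lo + 2 * h      ∎) ⟩
      lo + 2 * h ∸ T      ≡⟨ +-∸-comm (2 * h) (m/n*n≤m lo (2 * b)) ⟩
      lo ∸ T + 2 * h      ≡⟨ cong (_+ 2 * h) (sym (m%n≡m∸m/n*n lo (2 * b))) ⟩
      lo % (2 * b) + 2 * h <⟨ +-monoˡ-< (2 * h) (m%n<n lo (2 * b)) ⟩
      2 * b + 2 * h       ∎
      where open ≤-Reasoning
    shifted-inj : ∀ {x y} → Q x → Q y → x ∸ T ≡ y ∸ T → x ≡ y
    shifted-inj Qx Qy = ∸-cancelʳ-≡ (T≤ Qx) (T≤ Qy)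
    shifted-adj : ∀ {x y} → Q x → Q y → Adj∞ x y → Adj∞ (x ∸ T) (y ∸ T)
    shifted-adj Qx Qy = Adj∞-∸ q (T≤ Qx) (T≤ Qy)

  base-cycle : ∀ {N} → 3 ≤ d (0 mod b) → suc (d (0 mod b)) ≤ N →
               HasCycle N Adj∞ (suc (d (0 mod b)))
  base-cycle 3≤d L≤N =
    (λ i → i) , m≤n⇒m≤1+n 3≤d , (λ i i<L → <-≤-trans i<L L≤N) , (λ _ _ _ _ e → e) ,
    (λ _ _ → inj₁ refl) , inj₂ (inj₂ (inj₂ (0 , refl , refl)))

  module Lifting (r S : ℕ) (d≤S : ∀ j → d j ≤ S) (1≤S : 1 ≤ S) where

    n : ℕ
    n = 2 * (b * r)

    even-representative : ∀ {p t} → ModEq n p (2 * t) → ∃[ s ] (p ≡ 2 * s × s mod b ≡ t mod b)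
    even-representative {p} {t} p≡2t with ModEq-double⇒even (ModEq-divisor {r = r}
      (subst (λ k → ModEq k p (2 * t)) (sym (*-assoc 2 b r)) p≡2t))
    ... | s , p≡2s , s≡t = s , p≡2s , ModEq⇒mod≡ s≡t

    Lift : ℕ → ℕ → Set
    Lift p v = ∃[ p′ ] (ModEq n p′ v × Adj∞ p p′ × ∣ p - p′ ∣ ≤ S)

    lift-chord : ∀ {t p v} → ModEq n p (2 * t) → ModEq n v (2 * t + d (t mod b)) → Lift p v
    lift-chord {t} {p} {v} p≡2t v≡ with even-representative p≡2t
    ... | s , p≡2s , s≡t = p + d (s mod b) , p′≡v , inj₂ (inj₂ (inj₁ (s , p≡2s , refl))) ,
                           subst (_≤ S) (sym (∣m-m+n∣≡n p _)) (d≤S _)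
      where
      p′≡v : ModEq n (p + d (s mod b)) v
      p′≡v = subst (λ j → ModEq n (p + d j) v) (sym s≡t) (ModEq-trans (ModEq-+ʳ _ p≡2t) (ModEq-sym v≡))

    lift-chord⁻¹ : ∀ {t p′} → ModEq n (p′ + d (t mod b)) (2 * t + d (t mod b)) →
                   Lift (p′ + d (t mod b)) (2 * t)
    lift-chord⁻¹ {t} {p′} p≡ with even-representative (ModEq-+ʳ⁻¹ (d (t mod b)) p≡)
    ... | s , p′≡2s , s≡t = p′ , ModEq-+ʳ⁻¹ _ p≡ ,
                           inj₂ (inj₂ (inj₂ (s , p′≡2s , cong (λ j → p′ + d j) (sym s≡t)))) ,
                           subst (_≤ S) (sym (trans (∣-∣-comm (p′ + _) p′) (∣m-m+n∣≡n p′ _))) (d≤S _)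

    lift-edge : ∀ {u v p} → Adj b d (b * r) u v → ModEq n p u → S ≤ p → Lift p v
    lift-edge {p = p} (_ , _ , inj₁ v≡1+u) p≡u _ =
      suc p , ModEq-trans (ModEq-suc p≡u) (ModEq-sym v≡1+u) , inj₁ refl ,
      subst (_≤ S) (sym (∣n-1+n∣≡1 p)) 1≤S
    lift-edge {p = zero} (_ , _ , inj₂ (inj₁ _)) _ S≤0 = ⊥-elim (<⇒≱ 1≤S S≤0)
    lift-edge {p = suc p} (_ , _ , inj₂ (inj₁ u≡1+v)) 1+p≡u _ =
      p , ModEq-suc⁻¹ (ModEq-trans 1+p≡u u≡1+v) , inj₂ (inj₁ refl) ,
      subst (_≤ S) (sym (trans (∣-∣-comm (suc p) p) (∣n-1+n∣≡1 p))) 1≤S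
    lift-edge (_ , _ , inj₂ (inj₂ (inj₁ (t , refl , v≡)))) p≡u _ = lift-chord p≡u v≡
    lift-edge {p = p} (_ , _ , inj₂ (inj₂ (inj₂ (t , refl , u≡)))) p≡u S≤p =
      subst (λ k → Lift k (2 * t)) p∸e+e≡p
        (lift-chord⁻¹ (subst (λ k → ModEq n k _) (sym p∸e+e≡p) (ModEq-trans p≡u u≡)))
      where
      p∸e+e≡p : p ∸ d (t mod b) + d (t mod b) ≡ p
      p∸e+e≡p = m∸n+n≡m (≤-trans (d≤S _) S≤p)

    record WalkLift (k : ℕ) (c : ℕ → ℕ) (p : ℕ) : Set where
      field
        P : ℕ → ℕ
        starts : P 0 ≡ p
        over : ∀ i → i ≤ k → ModEq n (P i) (c i)
        near : ∀ i → i ≤ k → ∣ p - P i ∣ ≤ i * S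
        adjacent : ∀ i → i < k → Adj∞ (P i) (P (suc i))

    lift-walk : ∀ k c p → (∀ i → i < k → Adj b d (b * r) (c i) (c (suc i))) →
                ModEq n p (c 0) → k * S ≤ p → WalkLift k c p
    lift-walk zero c p _ p≡c₀ _ = record
      { P = λ _ → p ; starts = refl
      ; over = λ { zero _ → p≡c₀ }
      ; near = λ { zero _ → ≤-reflexive (∣n-n∣≡0 p) }
      ; adjacent = λ _ () }
    lift-walk (suc k) c p c-adj p≡c₀ [1+k]S≤p = extend (lift-edge (c-adj 0 z<s) p≡c₀ S≤p)
      where
      S≤p : S ≤ p
      S≤p = ≤-trans (m≤m+n S (k * S)) [1+k]S≤p
      extend : Lift p (c 1) → WalkLift (suc k) c p
      extend (p₁ , p₁≡c₁ , p~p₁ , ∣p-p₁∣≤S) = record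
        { P = p ◂ P ; starts = refl ; over = over′ ; near = near′ ; adjacent = adjacent′ }
        where
        tail = lift-walk k (c ∘ suc) p₁ (λ i i<k → c-adj (suc i) (s≤s i<k)) p₁≡c₁
                 (∣m-n∣≤o∧o+k≤m⇒k≤n [1+k]S≤p ∣p-p₁∣≤S)
        open WalkLift tail
        over′ : ∀ i → i ≤ suc k → ModEq n ((p ◂ P) i) (c i)
        over′ zero _ = p≡c₀
        over′ (suc i) (s≤s i≤k) = over i i≤k
        near′ : ∀ i → i ≤ suc k → ∣ p - (p ◂ P) i ∣ ≤ i * S
        near′ zero _ = ≤-reflexive (∣n-n∣≡0 p)
        near′ (suc i) (s≤s i≤k) = ≤-trans (∣-∣-triangle p p₁ (P i)) (+-mono-≤ ∣p-p₁∣≤S (near i i≤k))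
        adjacent′ : ∀ i → i < suc k → Adj∞ ((p ◂ P) i) ((p ◂ P) (suc i))
        adjacent′ zero _ = subst (Adj∞ p) (sym starts) p~p₁
        adjacent′ (suc i) (s≤s i<k) = adjacent i i<k

    lift-cycle : ∀ {ℓ c} → IsCycle n (Adj b d (b * r)) ℓ c → ℓ * S < n →
                 HasCycle (2 * b + 2 * (ℓ * S)) Adj∞ ℓ
    lift-cycle {suc k} {c} (3≤ℓ , c<n , c-inj , c-adj , c-close) ℓS<n =
      close (lift-edge c-close (over k ≤-refl) S≤Pk)
      where
      -- Starting the lift at c 0 + 2m leaves room for the walk to descend by up to ℓS.
      p₀ = c 0 + n
      ℓS≤p₀ : suc k * S ≤ p₀
      ℓS≤p₀ = ≤-trans (<⇒≤ ℓS<n) (m≤n+m n (c 0))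
      open WalkLift (lift-walk k c p₀ (λ i i<k → c-adj i (s≤s i<k)) (ModEq-+n n (c 0))
                               (≤-trans (m≤n+m (k * S) S) ℓS≤p₀))
      S≤Pk : S ≤ P k
      S≤Pk = ∣m-n∣≤o∧o+k≤m⇒k≤n (subst (_≤ p₀) (+-comm S (k * S)) ℓS≤p₀) (near k ≤-refl)
      near-ℓ : ∀ i → i < suc k → ∣ p₀ - P i ∣ ≤ suc k * S
      near-ℓ i (s≤s i≤k) = ≤-trans (near i i≤k) (*-monoˡ-≤ S (m≤n⇒m≤1+n i≤k))
      P-inj : ∀ i j → i < suc k → j < suc k → P i ≡ P j → i ≡ j
      P-inj i j (s≤s i≤k) (s≤s j≤k) Pi≡Pj = c-inj i j (s≤s i≤k) (s≤s j≤k) (ModEq-close⇒≡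
        (ModEq-trans (ModEq-sym (over i i≤k)) (subst (λ x → ModEq n x (c j)) (sym Pi≡Pj) (over j j≤k)))
        (≤-<-trans (∣m-n∣≤m⊔n (c i) (c j)) (⊔-lub (c<n i (s≤s i≤k)) (c<n j (s≤s j≤k)))))
      close : Lift (P k) (c 0) → HasCycle (2 * b + 2 * (suc k * S)) Adj∞ (suc k)
      close (p′ , p′≡c₀ , Pk~p′ , ∣Pk-p′∣≤S) = cycle-window p₀ (suc k * S) ℓS≤p₀ near-ℓ lifted
        where
        p′≡p₀ : p′ ≡ p₀
        p′≡p₀ = ModEq-close⇒≡ (ModEq-trans p′≡c₀ (ModEq-sym (ModEq-+n n (c 0)))) (begin-strict
          ∣ p′ - p₀ ∣              ≡⟨ ∣-∣-comm p′ p₀ ⟩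
          ∣ p₀ - p′ ∣              ≤⟨ ∣-∣-triangle p₀ (P k) p′ ⟩
          ∣ p₀ - P k ∣ + ∣ P k - p′ ∣ ≤⟨ +-mono-≤ (near k ≤-refl) ∣Pk-p′∣≤S ⟩
          k * S + S                ≡⟨ +-comm (k * S) S ⟩
          suc k * S                <⟨ ℓS<n ⟩
          n                        ∎)
          where open ≤-Reasoning
        lifted : IsCycle (suc (p₀ + suc k * S)) Adj∞ (suc k) P
        lifted = 3≤ℓ , (λ i i<ℓ → s≤s (∣m-n∣≤o⇒n≤m+o {p₀} (near-ℓ i i<ℓ))) , P-inj ,
                 (λ { i (s≤s i<k) → adjacent i i<k }) ,
                 subst (Adj∞ (P k)) (trans p′≡p₀ (sym starts)) Pk~p′

  module Girth (3≤d : ∀ j → 3 ≤ d j) where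

    S : ℕ
    S = max 1 (tabulate d)

    d≤S : ∀ j → d j ≤ S
    d≤S j = v≤max⁺ 1 (tabulate d) (inj₂ (Any.map ≤-reflexive (∈-tabulate⁺ j)))

    1≤S : 1 ≤ S
    1≤S = ⊥≤max 1 (tabulate d)

    L : ℕ
    L = suc (d (0 mod b))

    W : ℕ
    W = 2 * b + 2 * (L * S)

    LS≤W : L * S ≤ W
    LS≤W = ≤-trans (m≤m+n (L * S) _) (m≤n+m _ (2 * b))

    L≤W : L ≤ W
    L≤W = ≤-trans (≤-trans (≤-reflexive (sym (*-identityʳ L))) (*-monoʳ-≤ L 1≤S)) LS≤W

    least-window-cycle : ∃ (Least (HasCycle W Adj∞))
    least-window-cycle = least-witness (hasCycle? adj∞?) L (base-cycle (3≤d _) L≤W)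

    module _ (i : ℕ) where

      m : ℕ
      m = b * (W + i)

      W≤2m : W ≤ 2 * m
      W≤2m = ≤-trans (m≤m+n W i) (≤-trans (m≤n*m (W + i) b) (m≤n*m m 2))

      window-cycle⇒cycle : ∀ {ℓ} → HasCycle W Adj∞ ℓ → HasCycle (2 * m) (Adj b d m) ℓ
      window-cycle⇒cycle (c , cyc) = c ,
        IsCycle-map {A = Adj∞} {B = Adj b d m} (_< 2 * m) (λ x → x) (λ x< → x<) (λ _ _ e → e)
          (Adj∞⇒Adj {m}) (λ j j<ℓ → <-≤-trans (proj₁ (proj₂ cyc) j j<ℓ) W≤2m) cyc

      short-cycle⇒window-cycle : ∀ {ℓ} → ℓ < L → HasCycle (2 * m) (Adj b d m) ℓ → HasCycle W Adj∞ ℓ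
      short-cycle⇒window-cycle {ℓ} ℓ<L (_ , cyc) =
        _ , IsCycle-≤ {A = Adj∞} ℓ-window≤W (proj₂ (Lifting.lift-cycle (W + i) S d≤S 1≤S cyc ℓS<2m))
        where
        ℓS<2m : ℓ * S < 2 * m
        ℓS<2m = begin-strict
          ℓ * S      <⟨ m<n+m (ℓ * S) 1≤S ⟩
          suc ℓ * S  ≤⟨ *-monoˡ-≤ S ℓ<L ⟩
          L * S      ≤⟨ LS≤W ⟩
          W          ≤⟨ W≤2m ⟩
          2 * m      ∎
          where open ≤-Reasoning
        ℓ-window≤W : 2 * b + 2 * (ℓ * S) ≤ W
        ℓ-window≤W = +-monoʳ-≤ (2 * b) (*-monoʳ-≤ 2 (*-monoˡ-≤ S (<⇒≤ ℓ<L)))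

      girth : ∀ {g} → Least (HasCycle W Adj∞) g → IsGirth (2 * m) (Adj b d m) g
      girth {g} (g-cycle , g-least) = window-cycle⇒cycle g-cycle , g-shortest
        where
        g-shortest : ∀ ℓ → HasCycle (2 * m) (Adj b d m) ℓ → g ≤ ℓ
        g-shortest ℓ cyc with L ≤? ℓ
        ... | yes L≤ℓ = ≤-trans (g-least L (base-cycle (3≤d _) L≤W)) L≤ℓ
        ... | no L≰ℓ = g-least ℓ (short-cycle⇒window-cycle (≰⇒> L≰ℓ) cyc)

    stable-girth : Σ ℕ λ k → 1 ≤ k × Σ ℕ λ g →
                   ∀ i → IsGirth (2 * (b * (k + i))) (Adj b d (b * (k + i))) g
    stable-girth = W , ≤-trans (s≤s z≤n) L≤W , proj₁ least-window-cycle ,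
                   λ i → girth i (proj₂ least-window-cycle)

mainTheorem2 : (b : ℕ) .{{_ : NonZero b}} (d : Fin b → ℕ) →
    (∀ j → ¬ (2 ∣ d j)) → (∀ j → 3 ≤ d j) →
    Σ ℕ λ k → 1 ≤ k × Σ ℕ λ g →
    ∀ i → (∀ j → d j + 3 ≤ 2 * (b * (k + i))) →
    Regular3 (2 * (b * (k + i))) (Adj b d (b * (k + i))) →
    IsGirth (2 * (b * (k + i))) (Adj b d (b * (k + i))) g
mainTheorem2 b d _ 3≤d with Cover.Girth.stable-girth b d 3≤d
... | k , 1≤k , g , girth = k , 1≤k , g , λ i _ _ → girth i
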